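{- The characteristic series $\mathbf{F}_{\mathrm{iso}}$ of the set of closed terms over $\{\mathsf{M}\}$ that are isolated (both minimal and maximal for $\preccurlyeq$) satisfies $$\mathbf{F}_{\mathrm{iso}} = \mathsf{M} + 2\,\mathsf{M}\mathsf{M} + \mathbf{F}_{\mathrm{iso}}\,\bar\star\,\mathbf{F}_{\mathrm{iso}} - \mathsf{M}\,\bar\star\,\mathbf{F}_{\mathrm{iso}} - \bar\star(\Delta(\mathbf{F}_{\mathrm{iso}})).$$
   Context: Terms over $\{\mathsf{M}\}$: variables $\mathsf{x}_i$, the constant $\mathsf{M}$, and applications $\mathfrak{t}_1\mathfrak{t}_2$ (binary trees); a term is closed if it contains no variable. $\mathfrak{t}\Rightarrow\mathfrak{t}'$ iff $\mathfrak{t}'$ is obtained from $\mathfrak{t}$ by replacing one subterm $\mathsf{M}\mathfrak{s}$ by $\mathfrak{s}\mathfrak{s}$; $\preccurlyeq$ is its reflexive transitive closure, a partial order on all terms; minimality/maximality refer to this poset. Let $\mathbb{K}$ be a field of characteristic zero. A series on terms is a map $\mathbf{F}$ from terms to $\mathbb{K}$, written $\sum_\mathfrak{t}\langle\mathfrak{t},\mathbf{F}\rangle\mathfrak{t}$; the characteristic series of a set $S$ is $\sum_{\mathfrak{t}\in S}\mathfrak{t}$. $\mathbf{F}_1\,\bar\star\,\mathbf{F}_2 := \sum_{\mathfrak{t}_1,\mathfrak{t}_2}\langle\mathfrak{t}_1,\mathbf{F}_1\rangle\langle\mathfrak{t}_2,\mathbf{F}_2\rangle\,\mathfrak{t}_1\mathfrak{t}_2$,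 and $\bar\star(\Delta(\mathbf{F})) := \sum_\mathfrak{t}\langle\mathfrak{t},\mathbf{F}\rangle\,\mathfrak{t}\mathfrak{t}$ (composition of the diagonal coproduct $\mathfrak{t}\mapsto\mathfrak{t}\otimes\mathfrak{t}$ with $\mathfrak{t}_1\otimes\mathfrak{t}_2\mapsto\mathfrak{t}_1\mathfrak{t}_2$). -}

module Defs where

open import Level using (Level; _⊔_) renaming (suc to lsuc)
open import Data.Nat using (ℕ; zero; suc) renaming (_≟_ to _≟ⁿ_)
open import Data.Product using (_×_; ∃)
open import Data.Empty using (⊥)
open import Relation.Nullary using (¬_; Dec; yes; no)
open import Relation.Binary.PropositionalEquality using (_≡_; refl; cong; cong₂)
open import Relation.Binary.Construct.Closure.ReflexiveTransitive using (Star)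
open import Algebra.Bundles using (CommutativeRing)

data Term : Set where
  var : ℕ → Term
  M   : Term
  _·_ : Term → Term → Term

infixl 20 _·_

data Closed : Term → Set where
  closed-M : Closed M
  closed-· : ∀ {t₁ t₂} → Closed t₁ → Closed t₂ → Closed (t₁ · t₂)

data _⇒_ : Term → Term → Set where
  root  : ∀ s → (M · s) ⇒ (s · s)
  left  : ∀ {t₁ t₁′} t₂ → t₁ ⇒ t₁′ → (t₁ · t₂) ⇒ (t₁′ · t₂)
  right : ∀ t₁ {t₂ t₂′} → t₂ ⇒ t₂′ → (t₁ · t₂) ⇒ (t₁ · t₂′)

_≼_ : Term → Term → Set
_≼_ = Star _⇒_

Minimal : Term → Set
Minimal t = ∀ t′ → t′ ≼ t → t′ ≡ t

Maximal : Term → Set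
Maximal t = ∀ t′ → t ≼ t′ → t′ ≡ t

IsoClosed : Term → Set
IsoClosed t = Closed t × Minimal t × Maximal t

_≟ᵗ_ : (s t : Term) → Dec (s ≡ t)
var i ≟ᵗ var j with i ≟ⁿ j
... | yes refl = yes refl
... | no ne = no λ { refl → ne refl }
var _ ≟ᵗ M = no λ ()
var _ ≟ᵗ (_ · _) = no λ ()
M ≟ᵗ var _ = no λ ()
M ≟ᵗ M = yes refl
M ≟ᵗ (_ · _) = no λ ()
(_ · _) ≟ᵗ var _ = no λ ()
(_ · _) ≟ᵗ M = no λ ()
(s₁ · s₂) ≟ᵗ (t₁ · t₂) with s₁ ≟ᵗ t₁ | s₂ ≟ᵗ t₂
... | yes refl | yes refl = yes refl
... | no ne | _ = no λ { refl → ne refl }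
... | yes _ | no ne = no λ { refl → ne refl }

natCast : ∀ {c ℓ} (R : CommutativeRing c ℓ) → ℕ → CommutativeRing.Carrier R
natCast R zero = CommutativeRing.0# R
natCast R (suc n) = CommutativeRing._+_ R (CommutativeRing.1# R) (natCast R n)

record CharZeroField (c ℓ : Level) : Set (lsuc (c ⊔ ℓ)) where
  field
    commRing : CommutativeRing c ℓ
  open CommutativeRing commRing public
  field
    1≉0      : ¬ (1# ≈ 0#)
    inverse  : ∀ x → ¬ (x ≈ 0#) → ∃ λ y → (x * y) ≈ 1#
    charZero : ∀ n → ¬ (natCast commRing (suc n) ≈ 0#)

module Series {c ℓ : Level} (K : CharZeroField c ℓ) where
  open CharZeroField K

  Ser : Set c
  Ser = Term → Carrier

  _≈ˢ_ : Ser → Ser → Set ℓ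
  F ≈ˢ G = ∀ t → F t ≈ G t

  _+ˢ_ : Ser → Ser → Ser
  (F +ˢ G) t = F t + G t

  _-ˢ_ : Ser → Ser → Ser
  (F -ˢ G) t = F t + (- G t)

  _·ˢ_ : Carrier → Ser → Ser
  (a ·ˢ F) t = a * F t

  single : Term → Ser
  single s t with s ≟ᵗ t
  ... | yes _ = 1#
  ... | no _ = 0#

  -- F₁ ⋆̄ F₂ = Σ ⟨t₁,F₁⟩⟨t₂,F₂⟩ t₁t₂
  _⋆̄_ : Ser → Ser → Ser
  (F₁ ⋆̄ F₂) (var _) = 0#
  (F₁ ⋆̄ F₂) M = 0#
  (F₁ ⋆̄ F₂) (t₁ · t₂) = F₁ t₁ * F₂ t₂

  -- ⋆̄(Δ(F)) = Σ ⟨t,F⟩ t t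
  ⋆̄Δ : Ser → Ser
  ⋆̄Δ F (var _) = 0#
  ⋆̄Δ F M = 0#
  ⋆̄Δ F (t₁ · t₂) with t₁ ≟ᵗ t₂
  ... | yes _ = F t₁
  ... | no _ = 0#

  IsCharacteristic : (Term → Set) → Ser → Set ℓ
  IsCharacteristic P F = ∀ t → (P t → F t ≈ 1#) × (¬ P t → F t ≈ 0#)

{-# OPTIONS --safe #-}
module Submission where

open import Defs
open import Level using (Level; _⊔_)
open import Algebra.Bundles using (Ring)
open import Data.Product using (_×_; _,_; proj₁; proj₂)
open import Function.Bundles using (_⇔_; mk⇔; Equivalence)
open import Function.Construct.Symmetry using (⇔-sym)
open import Relation.Nullary using (¬_; Dec; yes; no; contradiction)
open import Relation.Nullary.Decidable using (_×-dec_)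
import Relation.Nullary.Decidable as Dec
open import Relation.Unary using (Decidable)
open import Relation.Binary.PropositionalEquality as ≡ using (_≡_; _≢_; refl; cong)
open import Relation.Binary.Construct.Closure.ReflexiveTransitive using (ε; _◅_; gmap)

-- A step M s ⇒ s s is available exactly at the redexes, so a closed term is
-- maximal iff it contains no redex M s with s ≠ M, and minimal iff it contains
-- no "square" s s with s ≠ M.  Hence M and M M are isolated, and any other
-- application t₁ t₂ is isolated iff t₁ and t₂ are, t₁ ≠ M and t₁ ≠ t₂.  Reading
-- this off coefficientwise: F ⋆̄ F counts the pairs of isolated terms, from which
-- M ⋆̄ F removes those with t₁ = M and ⋆̄Δ F those with t₁ = t₂; M M is removed by
-- both, which the term 2 M M compensates.

·-injectiveˡ : ∀ {s₁ s₂ t₁ t₂} → s₁ · s₂ ≡ t₁ · t₂ → s₁ ≡ t₁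
·-injectiveˡ refl = refl

·-injectiveʳ : ∀ {s₁ s₂ t₁ t₂} → s₁ · s₂ ≡ t₁ · t₂ → s₂ ≡ t₂
·-injectiveʳ refl = refl

≼-congˡ : ∀ {t₁ t₁′} t₂ → t₁ ≼ t₁′ → (t₁ · t₂) ≼ (t₁′ · t₂)
≼-congˡ t₂ = gmap (_· t₂) (left t₂)

≼-congʳ : ∀ t₁ {t₂ t₂′} → t₂ ≼ t₂′ → (t₁ · t₂) ≼ (t₁ · t₂′)
≼-congʳ t₁ = gmap (t₁ ·_) (right t₁)

Maximal-by-step : ∀ {t} → (∀ {t′} → t ⇒ t′ → t′ ≡ t) → Maximal t
Maximal-by-step fixed t′ ε = refl
Maximal-by-step fixed t′ (s ◅ ss) with fixed s
... | refl = Maximal-by-step fixed t′ ss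

Minimal-by-step : ∀ {t} → (∀ {t′} → t′ ⇒ t → t′ ≡ t) → Minimal t
Minimal-by-step fixed t′ ε = refl
Minimal-by-step fixed t′ (s ◅ ss) with Minimal-by-step fixed _ ss
... | refl = fixed s

IsoClosed-·ˡ : ∀ {t₁ t₂} → IsoClosed (t₁ · t₂) → IsoClosed t₁
IsoClosed-·ˡ {t₂ = t₂} (closed-· c₁ _ , min , max) =
  c₁ , (λ t′ p → ·-injectiveˡ (min (t′ · t₂) (≼-congˡ t₂ p)))
     , (λ t′ p → ·-injectiveˡ (max (t′ · t₂) (≼-congˡ t₂ p)))

IsoClosed-·ʳ : ∀ {t₁ t₂} → IsoClosed (t₁ · t₂) → IsoClosed t₂
IsoClosed-·ʳ {t₁} (closed-· _ c₂ , min , max) =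
  c₂ , (λ t′ p → ·-injectiveʳ (min (t₁ · t′) (≼-congʳ t₁ p)))
     , (λ t′ p → ·-injectiveʳ (max (t₁ · t′) (≼-congʳ t₁ p)))

Maximal-M·⇒≡M : ∀ {t} → Maximal (M · t) → t ≡ M
Maximal-M·⇒≡M {t} max = ·-injectiveˡ (max (t · t) (root t ◅ ε))

Minimal-square⇒≡M : ∀ {t} → Minimal (t · t) → t ≡ M
Minimal-square⇒≡M {t} min = ≡.sym (·-injectiveˡ (min (M · t) (root t ◅ ε)))

IsoClosed-M : IsoClosed M
IsoClosed-M = closed-M , Minimal-by-step (λ ()) , Maximal-by-step (λ ())

IsoClosed-M·M : IsoClosed (M · M)
IsoClosed-M·M = closed-· closed-M closed-M , Minimal-by-step into , Maximal-by-step out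
  where
  into : ∀ {t} → t ⇒ (M · M) → t ≡ M · M
  into (root _) = refl
  out : ∀ {t} → (M · M) ⇒ t → t ≡ M · M
  out (root _) = refl

IsoClosed-· : ∀ {t₁ t₂} → IsoClosed t₁ → IsoClosed t₂ → t₁ ≢ M → t₁ ≢ t₂ →
              IsoClosed (t₁ · t₂)
IsoClosed-· {t₁} {t₂} (c₁ , min₁ , max₁) (c₂ , min₂ , max₂) t₁≢M t₁≢t₂ =
  closed-· c₁ c₂ , Minimal-by-step into , Maximal-by-step out
  where
  into : ∀ {t} → t ⇒ (t₁ · t₂) → t ≡ t₁ · t₂
  into (root _)    = contradiction refl t₁≢t₂
  into (left _ s)  = cong (_· t₂) (min₁ _ (s ◅ ε))
  into (right _ s) = cong (t₁ ·_) (min₂ _ (s ◅ ε))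
  out : ∀ {t} → (t₁ · t₂) ⇒ t → t ≡ t₁ · t₂
  out (root _)    = contradiction refl t₁≢M
  out (left _ s)  = cong (_· t₂) (max₁ _ (s ◅ ε))
  out (right _ s) = cong (t₁ ·_) (max₂ _ (s ◅ ε))

¬IsoClosed-var : ∀ i → ¬ IsoClosed (var i)
¬IsoClosed-var i (() , _)

¬IsoClosed-M· : ∀ {t} → t ≢ M → ¬ IsoClosed (M · t)
¬IsoClosed-M· t≢M (_ , _ , max) = t≢M (Maximal-M·⇒≡M max)

¬IsoClosed-square : ∀ {t} → t ≢ M → ¬ IsoClosed (t · t)
¬IsoClosed-square t≢M (_ , min , _) = t≢M (Minimal-square⇒≡M min)

IsoClosed-·⇔ : ∀ {t₁ t₂} → t₁ ≢ M → t₁ ≢ t₂ →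
               IsoClosed (t₁ · t₂) ⇔ (IsoClosed t₁ × IsoClosed t₂)
IsoClosed-·⇔ t₁≢M t₁≢t₂ =
  mk⇔ (λ iso → IsoClosed-·ˡ iso , IsoClosed-·ʳ iso)
      (λ (iso₁ , iso₂) → IsoClosed-· iso₁ iso₂ t₁≢M t₁≢t₂)

data ApplicationView : Term → Term → Set where
  M·M      : ApplicationView M M
  M·_      : ∀ {t} → t ≢ M → ApplicationView M t
  square   : ∀ {t} → t ≢ M → ApplicationView t t
  generic  : ∀ {t₁ t₂} → t₁ ≢ M → t₁ ≢ t₂ → ApplicationView t₁ t₂

applicationView : ∀ t₁ t₂ → ApplicationView t₁ t₂
applicationView t₁ t₂ with t₁ ≟ᵗ M | t₂ ≟ᵗ M | t₁ ≟ᵗ t₂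
... | yes refl | yes refl | _        = M·M
... | yes refl | no t₂≢M  | _        = M· t₂≢M
... | no t₁≢M  | _        | yes refl = square t₁≢M
... | no t₁≢M  | _        | no t₁≢t₂ = generic t₁≢M t₁≢t₂

IsoClosed? : Decidable IsoClosed
IsoClosed? (var i)   = no (¬IsoClosed-var i)
IsoClosed? M         = yes IsoClosed-M
IsoClosed? (t₁ · t₂) with applicationView t₁ t₂
... | M·M                = yes IsoClosed-M·M
... | M· t≢M             = no (¬IsoClosed-M· t≢M)
... | square t≢M         = no (¬IsoClosed-square t≢M)
... | generic t₁≢M t₁≢t₂ = Dec.map (⇔-sym (IsoClosed-·⇔ t₁≢M t₁≢t₂))
                                   (IsoClosed? t₁ ×-dec IsoClosed? t₂)

module Indicators {r ℓ} (R : Ring r ℓ) where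
  open Ring R renaming (refl to ≈-refl; sym to ≈-sym; trans to ≈-trans)

  private variable
    a b : Level
    A : Set a
    B : Set b
    x y : Carrier

  -- Series.IsCharacteristic P F unfolds to ∀ t → Indicator (P t) (F t).
  Indicator : Set a → Carrier → Set (a ⊔ ℓ)
  Indicator A x = (A → x ≈ 1#) × (¬ A → x ≈ 0#)

  Indicator-resp-⇔ : A ⇔ B → Indicator A x → Indicator B x
  Indicator-resp-⇔ A⇔B (x≈1 , x≈0) = (λ b → x≈1 (from b)) , (λ ¬b → x≈0 (λ a → ¬b (to a)))
    where open Equivalence A⇔B

  Indicator-unique : Dec A → Indicator A x → Indicator A y → x ≈ y
  Indicator-unique (yes a) (x≈1 , _) (y≈1 , _) = ≈-trans (x≈1 a) (≈-sym (y≈1 a))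
  Indicator-unique (no ¬a) (_ , x≈0) (_ , y≈0) = ≈-trans (x≈0 ¬a) (≈-sym (y≈0 ¬a))

  Indicator-* : Dec A → Indicator A x → Indicator B y → Indicator (A × B) (x * y)
  Indicator-* {A = A} {x = x} {B = B} {y = y} A? (x≈1 , x≈0) (y≈1 , y≈0) = both , notBoth A?
    where
    both : A × B → x * y ≈ 1#
    both (a , b) = ≈-trans (*-cong (x≈1 a) (y≈1 b)) (*-identityˡ 1#)
    notBoth : Dec A → ¬ (A × B) → x * y ≈ 0#
    notBoth (yes a) ¬ab = ≈-trans (*-congˡ (y≈0 (λ b → ¬ab (a , b)))) (zeroʳ x)
    notBoth (no ¬a) _   = ≈-trans (*-congʳ (x≈0 ¬a)) (zeroˡ y)

  Indicator-idempotent : Dec A → Indicator A x → x * x ≈ x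
  Indicator-idempotent A? χ = Indicator-unique (A? ×-dec A?) (Indicator-* A? χ χ)
                                (Indicator-resp-⇔ (mk⇔ (λ a → a , a) proj₁) χ)

module Coefficients {c ℓ} (K : CharZeroField c ℓ) where
  open CharZeroField K renaming (refl to ≈-refl; sym to ≈-sym; trans to ≈-trans)
  open Series K
  open Indicators ring
  open import Algebra.Properties.Ring ring using (-0#≈0#; x≈y⇒x∙y⁻¹≈ε; xyx⁻¹≈y)
  open import Relation.Binary.Reasoning.Setoid setoid

  single-other : ∀ {s t} → s ≢ t → single s t ≈ 0#
  single-other {s} {t} s≢t with s ≟ᵗ t
  ... | yes s≡t = contradiction s≡t s≢t
  ... | no _    = ≈-refl

  ⋆̄Δ-square : ∀ F t → ⋆̄Δ F (t · t) ≈ F t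
  ⋆̄Δ-square F t with t ≟ᵗ t
  ... | yes _   = ≈-refl
  ... | no t≢t = contradiction refl t≢t

  ⋆̄Δ-off-diagonal : ∀ F {t₁ t₂} → t₁ ≢ t₂ → ⋆̄Δ F (t₁ · t₂) ≈ 0#
  ⋆̄Δ-off-diagonal F {t₁} {t₂} t₁≢t₂ with t₁ ≟ᵗ t₂
  ... | yes t₁≡t₂ = contradiction t₁≡t₂ t₁≢t₂
  ... | no _      = ≈-refl

  x-z≈x : ∀ x {z} → z ≈ 0# → x + - z ≈ x
  x-z≈x x z≈0 = ≈-trans (+-congˡ (≈-trans (-‿cong z≈0) -0#≈0#)) (+-identityʳ x)

  two : Carrier
  two = natCast commRing 2

  module _ (F : Ser) (χ : IsCharacteristic IsoClosed F) where

    RHS : Ser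
    RHS = (((single M +ˢ (two ·ˢ single (M · M))) +ˢ (F ⋆̄ F)) -ˢ (single M ⋆̄ F)) -ˢ ⋆̄Δ F

    RHS≈single-M : ∀ t → single (M · M) t ≈ 0# → (F ⋆̄ F) t ≈ 0# →
                   (single M ⋆̄ F) t ≈ 0# → ⋆̄Δ F t ≈ 0# → RHS t ≈ single M t
    RHS≈single-M t s≈0 p≈0 q≈0 d≈0 = begin
      (((single M t + two * single (M · M) t) + (F ⋆̄ F) t) + - (single M ⋆̄ F) t) + - ⋆̄Δ F t
        ≈⟨ x-z≈x _ d≈0 ⟩
      ((single M t + two * single (M · M) t) + (F ⋆̄ F) t) + - (single M ⋆̄ F) t
        ≈⟨ x-z≈x _ q≈0 ⟩
      (single M t + two * single (M · M) t) + (F ⋆̄ F) t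
        ≈⟨ +-cong (+-congˡ (≈-trans (*-congˡ s≈0) (zeroʳ two))) p≈0 ⟩
      (single M t + 0#) + 0#
        ≈⟨ ≈-trans (+-identityʳ _) (+-identityʳ _) ⟩
      single M t ∎

    RHS-· : ∀ {t₁ t₂} → t₁ · t₂ ≢ M · M →
            RHS (t₁ · t₂) ≈ (F t₁ * F t₂ + - (single M t₁ * F t₂)) + - ⋆̄Δ F (t₁ · t₂)
    RHS-· {t₁} {t₂} t≢M·M = +-congʳ (+-congʳ (≈-trans (+-congʳ two*s≈0) (+-identityˡ _)))
      where
      two*s≈0 : 0# + two * single (M · M) (t₁ · t₂) ≈ 0#
      two*s≈0 = ≈-trans (+-identityˡ _)
                        (≈-trans (*-congˡ (single-other (≡.≢-sym t≢M·M))) (zeroʳ two))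

    F-M : F M ≈ 1#
    F-M = proj₁ (χ M) IsoClosed-M

    at-var : ∀ i → F (var i) ≈ RHS (var i)
    at-var i = ≈-trans (proj₂ (χ (var i)) (¬IsoClosed-var i))
                       (≈-sym (RHS≈single-M (var i) ≈-refl ≈-refl ≈-refl ≈-refl))

    at-M : F M ≈ RHS M
    at-M = ≈-trans F-M (≈-sym (RHS≈single-M M ≈-refl ≈-refl ≈-refl ≈-refl))

    at-M·M : F (M · M) ≈ RHS (M · M)
    at-M·M = ≈-trans (proj₁ (χ (M · M)) IsoClosed-M·M) (≈-sym (begin
      RHS (M · M)
        ≡⟨⟩
      (((0# + two * 1#) + F M * F M) + - (1# * F M)) + - F M
        ≈⟨ +-congʳ (+-assoc _ _ _) ⟩
      ((0# + two * 1#) + (F M * F M + - (1# * F M))) + - F M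
        ≈⟨ +-cong (+-congˡ (x≈y⇒x∙y⁻¹≈ε (*-congʳ F-M))) (-‿cong F-M) ⟩
      ((0# + two * 1#) + 0#) + - 1#
        ≈⟨ +-congʳ (≈-trans (+-identityʳ _) (≈-trans (+-identityˡ _) (*-identityʳ two))) ⟩
      (1# + (1# + 0#)) + - 1#
        ≈⟨ ≈-trans (xyx⁻¹≈y 1# (1# + 0#)) (+-identityʳ 1#) ⟩
      1# ∎))

    at-M· : ∀ {t} → t ≢ M → F (M · t) ≈ RHS (M · t)
    at-M· {t} t≢M = ≈-trans (proj₂ (χ (M · t)) (¬IsoClosed-M· t≢M)) (≈-sym (begin
      RHS (M · t)                                       ≈⟨ RHS-· (λ e → t≢M (·-injectiveʳ e)) ⟩
      (F M * F t + - (1# * F t)) + - ⋆̄Δ F (M · t)      ≈⟨ x-z≈x _ (⋆̄Δ-off-diagonal F (≡.≢-sym t≢M)) ⟩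
      F M * F t + - (1# * F t)                          ≈⟨ x≈y⇒x∙y⁻¹≈ε (*-congʳ F-M) ⟩
      0# ∎))

    at-square : ∀ {t} → t ≢ M → F (t · t) ≈ RHS (t · t)
    at-square {t} t≢M = ≈-trans (proj₂ (χ (t · t)) (¬IsoClosed-square t≢M)) (≈-sym (begin
      RHS (t · t)                                       ≈⟨ RHS-· (λ e → t≢M (·-injectiveˡ e)) ⟩
      (F t * F t + - (single M t * F t)) + - ⋆̄Δ F (t · t)
        ≈⟨ +-cong (x-z≈x _ (≈-trans (*-congʳ (single-other (≡.≢-sym t≢M))) (zeroˡ _)))
                  (-‿cong (⋆̄Δ-square F t)) ⟩
      F t * F t + - F t
        ≈⟨ x≈y⇒x∙y⁻¹≈ε (Indicator-idempotent (IsoClosed? t) (χ t)) ⟩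
      0# ∎))

    at-generic : ∀ {t₁ t₂} → t₁ ≢ M → t₁ ≢ t₂ → F (t₁ · t₂) ≈ RHS (t₁ · t₂)
    at-generic {t₁} {t₂} t₁≢M t₁≢t₂ = ≈-trans F-t₁t₂≈F-t₁*F-t₂ (≈-sym (begin
      RHS (t₁ · t₂)                                     ≈⟨ RHS-· (λ e → t₁≢M (·-injectiveˡ e)) ⟩
      (F t₁ * F t₂ + - (single M t₁ * F t₂)) + - ⋆̄Δ F (t₁ · t₂)
        ≈⟨ x-z≈x _ (⋆̄Δ-off-diagonal F t₁≢t₂) ⟩
      F t₁ * F t₂ + - (single M t₁ * F t₂)
        ≈⟨ x-z≈x _ (≈-trans (*-congʳ (single-other (≡.≢-sym t₁≢M))) (zeroˡ _)) ⟩
      F t₁ * F t₂ ∎))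
      where
      F-t₁t₂≈F-t₁*F-t₂ : F (t₁ · t₂) ≈ F t₁ * F t₂
      F-t₁t₂≈F-t₁*F-t₂ = Indicator-unique (IsoClosed? t₁ ×-dec IsoClosed? t₂)
        (Indicator-resp-⇔ (IsoClosed-·⇔ t₁≢M t₁≢t₂) (χ (t₁ · t₂)))
        (Indicator-* (IsoClosed? t₁) (χ t₁) (χ t₂))

open Coefficients using (at-var; at-M; at-M·M; at-M·; at-square; at-generic)

proposition3p2p3 : {c ℓ : Level} (K : CharZeroField c ℓ) →
    let open CharZeroField K
        open Series K
    in (F : Ser) → IsCharacteristic IsoClosed F →
       F ≈ˢ ((((single M +ˢ (natCast commRing 2 ·ˢ single (M · M))) +ˢ (F ⋆̄ F)) -ˢ (single M ⋆̄ F)) -ˢ ⋆̄Δ F)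
proposition3p2p3 K F χ (var i) = at-var K F χ i
proposition3p2p3 K F χ M = at-M K F χ
proposition3p2p3 K F χ (t₁ · t₂) with applicationView t₁ t₂
... | M·M                = at-M·M K F χ
... | M· t≢M             = at-M· K F χ t≢M
... | square t≢M         = at-square K F χ t≢M
... | generic t₁≢M t₁≢t₂ = at-generic K F χ t₁≢M t₁≢t₂
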